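{- Let $\mathcal{A}\subseteq\{\mathsf{N},\mathsf{M},\mathsf{C}\}$. If $A\in\mathsf{E}\mathcal{A}$, then $\;\Rightarrow A$ is derivable in the end-active variant of $\mathsf{LNS}_{\mathsf{E}\mathcal{A}}$ extended with contraction and weakening.
   Context: Formulas: propositional variables, $\bot,\top,\neg,\land,\lor,\to,\Box$. $\mathsf{E}\mathcal{A}$ is the smallest set containing propositional tautologies and the axioms in $\mathcal{A}$ ($\mathsf{M}: \Box(A\land B)\to(\Box A\land\Box B)$, $\mathsf{C}: (\Box A\land\Box B)\to\Box(A\land B)$, $\mathsf{N}: \Box\top$), closed under modus ponens and rule (E): from $A\to B$ and $B\to A$ infer $\Box A\to\Box B$. Structures: $\mathcal{X}::=\Gamma\Rightarrow\Delta\mid\Gamma\Rightarrow\Delta\,/_{\mathsf e}(\Sigma\Rightarrow\Pi;\Omega\Rightarrow\Theta)\mid\Gamma\Rightarrow\Delta\,/\,\mathcal{X}$ with finite multisets of formulas; $\mathcal{S}\{\Gamma\Rightarrow\Delta\}$ has a distinguished component, $\mathcal{G}/\Gamma\Rightarrow\Delta$ has last component $\Gamma\Rightarrow\Delta$. $\mathsf{LNS}_{\mathsf{E}\mathcal{A}}$: propositional rules (zero-premiss $\mathcal{S}\{\Gamma,p\Rightarrow p,\Delta\}$ with $p$ atomic, $\mathcal{S}\{\Gamma,\bot\Rightarrow\Delta\}$, $\mathcal{S}\{\Gamma\Rightarrow\top,\Delta\}$, and the standard two-sided invertible rules for $\neg,\land,\lor,\to$ on one component), not applicable to sequents inside $/_{\mathsf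 e}$; $\Box^{\mathsf e}_R$: $\mathcal{G}/\Gamma\Rightarrow\Delta/_{\mathsf e}(\Rightarrow B;B\Rightarrow)$ / $\mathcal{G}/\Gamma\Rightarrow\Box B,\Delta$; $\Box^{\mathsf e}_L$: $\mathcal{G}/\Gamma\Rightarrow\Delta/\Sigma,A\Rightarrow\Pi$ and $\mathcal{G}/\Gamma\Rightarrow\Delta/\Omega\Rightarrow A,\Theta$ / $\mathcal{G}/\Gamma,\Box A\Rightarrow\Delta/_{\mathsf e}(\Sigma\Rightarrow\Pi;\Omega\Rightarrow\Theta)$; if $\mathsf{N}\in\mathcal{A}$: $\mathcal{G}/\Gamma\Rightarrow\Delta/\Rightarrow B$ / $\mathcal{G}/\Gamma\Rightarrow\Box B,\Delta$; if $\mathsf{M}\in\mathcal{A}$: $\mathcal{G}/_{\mathsf e}(\Sigma\Rightarrow\Pi;\Omega,\bot\Rightarrow\Theta)$ / $\mathcal{G}/_{\mathsf e}(\Sigma\Rightarrow\Pi;\Omega\Rightarrow\Theta)$; if $\mathsf{C}\in\mathcal{A}$: $\mathcal{G}/\Gamma\Rightarrow\Delta/_{\mathsf e}(\Sigma,A\Rightarrow\Pi;\Omega\Rightarrow\Theta)$ and $\mathcal{G}/\Gamma\Rightarrow\Delta/\Omega\Rightarrow A,\Theta$ / $\mathcal{G}/\Gamma,\Box A\Rightarrow\Delta/_{\mathsf e}(\Sigma\Rightarrow\Pi;\Omega\Rightarrow\Theta)$. Contraction and weakening: usual left/right rules inside a component. An application of a rule is end-active if the rightmost components of its premisses are active and the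 only active components (in premisses and conclusion) are the two rightmost ones; the end-active variant restricts all rules to end-active applications. -}

module Defs where

open import Data.Nat using (ℕ)
open import Data.Bool using (Bool; true; false; not; _∧_; _∨_)
open import Data.List using (List; []; _∷_; [_])
open import Data.List.Relation.Binary.Permutation.Propositional using (_↭_)
open import Relation.Binary.PropositionalEquality using (_≡_)

infixr 8 _∧'_
infixr 7 _∨'_
infixr 6 _⊃_

data Fm : Set where
  var  : ℕ → Fm
  ⊥'   : Fm
  ⊤'   : Fm
  ¬'_  : Fm → Fm
  _∧'_ : Fm → Fm → Fm
  _∨'_ : Fm → Fm → Fm
  _⊃_  : Fm → Fm → Fm
  □_   : Fm → Fm

-- Propositional tautologies (in the modal language): formulas true under
-- every Boolean valuation that assigns arbitrary truth values to
-- propositional variables and to boxed formulas (i.e. substitution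
-- instances of classical tautologies).

⟦_⟧ : Fm → (Fm → Bool) → Bool
⟦ var p ⟧  v = v (var p)
⟦ ⊥' ⟧     v = false
⟦ ⊤' ⟧     v = true
⟦ ¬' A ⟧   v = not (⟦ A ⟧ v)
⟦ A ∧' B ⟧ v = ⟦ A ⟧ v ∧ ⟦ B ⟧ v
⟦ A ∨' B ⟧ v = ⟦ A ⟧ v ∨ ⟦ B ⟧ v
⟦ A ⊃ B ⟧  v = not (⟦ A ⟧ v) ∨ ⟦ B ⟧ v
⟦ □ A ⟧    v = v (□ A)

Tautology : Fm → Set
Tautology A = (v : Fm → Bool) → ⟦ A ⟧ v ≡ true

record Axioms : Set where
  field
    hasN : Bool
    hasM : Bool
    hasC : Bool
open Axioms public

data E_⊢_ (𝒜 : Axioms) : Fm → Set where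
  taut  : ∀ {A} → Tautology A → E 𝒜 ⊢ A
  axM   : ∀ {A B} → hasM 𝒜 ≡ true → E 𝒜 ⊢ (□ (A ∧' B) ⊃ (□ A ∧' □ B))
  axC   : ∀ {A B} → hasC 𝒜 ≡ true → E 𝒜 ⊢ ((□ A ∧' □ B) ⊃ □ (A ∧' B))
  axN   : hasN 𝒜 ≡ true → E 𝒜 ⊢ □ ⊤'
  mp    : ∀ {A B} → E 𝒜 ⊢ (A ⊃ B) → E 𝒜 ⊢ A → E 𝒜 ⊢ B
  ruleE : ∀ {A B} → E 𝒜 ⊢ (A ⊃ B) → E 𝒜 ⊢ (B ⊃ A) → E 𝒜 ⊢ (□ A ⊃ □ B)

-- Sequents (pairs of finite multisets, represented as lists taken up to
-- permutation) and linear nested sequent structures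

infix 3 _⇒_
record Seq : Set where
  constructor _⇒_
  field
    ant : List Fm
    suc : List Fm

-- 𝒳 ::= Γ⇒Δ | Γ⇒Δ /ₑ (Σ⇒Π ; Ω⇒Θ) | Γ⇒Δ / 𝒳
infixr 4 _∷/_
data Str : Set where
  seq   : Seq → Str
  eblk  : Seq → Seq → Seq → Str
  _∷/_  : Seq → Str → Str

infixr 4 _⊲_
_⊲_ : List Seq → Str → Str
[] ⊲ X = X
(s ∷ G) ⊲ X = s ∷/ (G ⊲ X)

_≈ˢ_ : Seq → Seq → Set
(Γ ⇒ Δ) ≈ˢ (Γ' ⇒ Δ') = (Γ ↭ Γ') × (Δ ↭ Δ')
  where open import Data.Product using (_×_)

data _≈_ : Str → Str → Set where
  seq≈  : ∀ {s s'} → s ≈ˢ s' → seq s ≈ seq s'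
  eblk≈ : ∀ {s s' t t' u u'} → s ≈ˢ s' → t ≈ˢ t' → u ≈ˢ u' →
          eblk s t u ≈ eblk s' t' u'
  cons≈ : ∀ {s s' X X'} → s ≈ˢ s' → X ≈ X' → (s ∷/ X) ≈ (s' ∷/ X')

-- End-active variant of LNS_{E𝒜} extended with (end-active) contraction
-- and weakening.  Every rule acts only on the (two) rightmost components.

data LNS_⊢_ (𝒜 : Axioms) : Str → Set where
  perm : ∀ {X Y} → X ≈ Y → LNS 𝒜 ⊢ X → LNS 𝒜 ⊢ Y

  init : ∀ {G Γ Δ p} → LNS 𝒜 ⊢ (G ⊲ seq (var p ∷ Γ ⇒ var p ∷ Δ))
  ⊥L   : ∀ {G Γ Δ} → LNS 𝒜 ⊢ (G ⊲ seq (⊥' ∷ Γ ⇒ Δ))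
  ⊤R   : ∀ {G Γ Δ} → LNS 𝒜 ⊢ (G ⊲ seq (Γ ⇒ ⊤' ∷ Δ))

  ¬L : ∀ {G Γ Δ A} → LNS 𝒜 ⊢ (G ⊲ seq (Γ ⇒ A ∷ Δ)) →
       LNS 𝒜 ⊢ (G ⊲ seq (¬' A ∷ Γ ⇒ Δ))
  ¬R : ∀ {G Γ Δ A} → LNS 𝒜 ⊢ (G ⊲ seq (A ∷ Γ ⇒ Δ)) →
       LNS 𝒜 ⊢ (G ⊲ seq (Γ ⇒ ¬' A ∷ Δ))
  ∧L : ∀ {G Γ Δ A B} → LNS 𝒜 ⊢ (G ⊲ seq (A ∷ B ∷ Γ ⇒ Δ)) →
       LNS 𝒜 ⊢ (G ⊲ seq (A ∧' B ∷ Γ ⇒ Δ))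
  ∧R : ∀ {G Γ Δ A B} → LNS 𝒜 ⊢ (G ⊲ seq (Γ ⇒ A ∷ Δ)) →
       LNS 𝒜 ⊢ (G ⊲ seq (Γ ⇒ B ∷ Δ)) →
       LNS 𝒜 ⊢ (G ⊲ seq (Γ ⇒ A ∧' B ∷ Δ))
  ∨L : ∀ {G Γ Δ A B} → LNS 𝒜 ⊢ (G ⊲ seq (A ∷ Γ ⇒ Δ)) →
       LNS 𝒜 ⊢ (G ⊲ seq (B ∷ Γ ⇒ Δ)) →
       LNS 𝒜 ⊢ (G ⊲ seq (A ∨' B ∷ Γ ⇒ Δ))
  ∨R : ∀ {G Γ Δ A B} → LNS 𝒜 ⊢ (G ⊲ seq (Γ ⇒ A ∷ B ∷ Δ)) →
       LNS 𝒜 ⊢ (G ⊲ seq (Γ ⇒ A ∨' B ∷ Δ))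
  ⊃L : ∀ {G Γ Δ A B} → LNS 𝒜 ⊢ (G ⊲ seq (Γ ⇒ A ∷ Δ)) →
       LNS 𝒜 ⊢ (G ⊲ seq (B ∷ Γ ⇒ Δ)) →
       LNS 𝒜 ⊢ (G ⊲ seq (A ⊃ B ∷ Γ ⇒ Δ))
  ⊃R : ∀ {G Γ Δ A B} → LNS 𝒜 ⊢ (G ⊲ seq (A ∷ Γ ⇒ B ∷ Δ)) →
       LNS 𝒜 ⊢ (G ⊲ seq (Γ ⇒ A ⊃ B ∷ Δ))

  □R : ∀ {G Γ Δ B} →
       LNS 𝒜 ⊢ (G ⊲ eblk (Γ ⇒ Δ) ([] ⇒ [ B ]) ([ B ] ⇒ [])) →
       LNS 𝒜 ⊢ (G ⊲ seq (Γ ⇒ □ B ∷ Δ))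
  □L : ∀ {G Γ Δ Σ Π Ω Θ A} →
       LNS 𝒜 ⊢ (G ⊲ (Γ ⇒ Δ) ∷/ seq (A ∷ Σ ⇒ Π)) →
       LNS 𝒜 ⊢ (G ⊲ (Γ ⇒ Δ) ∷/ seq (Ω ⇒ A ∷ Θ)) →
       LNS 𝒜 ⊢ (G ⊲ eblk (□ A ∷ Γ ⇒ Δ) (Σ ⇒ Π) (Ω ⇒ Θ))
  ruleN : ∀ {G Γ Δ B} → hasN 𝒜 ≡ true →
       LNS 𝒜 ⊢ (G ⊲ (Γ ⇒ Δ) ∷/ seq ([] ⇒ [ B ])) →
       LNS 𝒜 ⊢ (G ⊲ seq (Γ ⇒ □ B ∷ Δ))
  ruleM : ∀ {G s Σ Π Ω Θ} → hasM 𝒜 ≡ true →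
       LNS 𝒜 ⊢ (G ⊲ eblk s (Σ ⇒ Π) (⊥' ∷ Ω ⇒ Θ)) →
       LNS 𝒜 ⊢ (G ⊲ eblk s (Σ ⇒ Π) (Ω ⇒ Θ))
  ruleC : ∀ {G Γ Δ Σ Π Ω Θ A} → hasC 𝒜 ≡ true →
       LNS 𝒜 ⊢ (G ⊲ eblk (Γ ⇒ Δ) (A ∷ Σ ⇒ Π) (Ω ⇒ Θ)) →
       LNS 𝒜 ⊢ (G ⊲ (Γ ⇒ Δ) ∷/ seq (Ω ⇒ A ∷ Θ)) →
       LNS 𝒜 ⊢ (G ⊲ eblk (□ A ∷ Γ ⇒ Δ) (Σ ⇒ Π) (Ω ⇒ Θ))

  WL : ∀ {G Γ Δ A} → LNS 𝒜 ⊢ (G ⊲ seq (Γ ⇒ Δ)) →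
       LNS 𝒜 ⊢ (G ⊲ seq (A ∷ Γ ⇒ Δ))
  WR : ∀ {G Γ Δ A} → LNS 𝒜 ⊢ (G ⊲ seq (Γ ⇒ Δ)) →
       LNS 𝒜 ⊢ (G ⊲ seq (Γ ⇒ A ∷ Δ))
  CL : ∀ {G Γ Δ A} → LNS 𝒜 ⊢ (G ⊲ seq (A ∷ A ∷ Γ ⇒ Δ)) →
       LNS 𝒜 ⊢ (G ⊲ seq (A ∷ Γ ⇒ Δ))
  CR : ∀ {G Γ Δ A} → LNS 𝒜 ⊢ (G ⊲ seq (Γ ⇒ A ∷ A ∷ Δ)) →
       LNS 𝒜 ⊢ (G ⊲ seq (Γ ⇒ A ∷ Δ))

-- Every theorem of E𝒜 is first derived in an auxiliary G3-style calculus Γ ⊩ Δ whose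
-- modal rule is the usual one-step rule for E𝒜: from A₁ … Aₙ ⇒ B and, unless M ∈ 𝒜,
-- from B ⇒ Aᵢ for every i, infer Γ, □A₁ … □Aₙ ⇒ □B, Δ, where n = 0 requires N and
-- n ≥ 2 requires C. Tautologies are found by root-first proof search: the premisses of a
-- propositional rule are valid and lighter, and a valid sequent of literals shares a literal,
-- as the valuation making exactly its antecedent true shows. Modus ponens needs cut, which is
-- admissible by induction on the cut formula; for a cut on □D the two modal rules merge into
-- one whose box context is the union of both contexts minus D (without C, the second context
-- is D alone). Finally a ⊩-derivation is replayed end-actively in LNS: propositional steps act
-- on the last component, and a modal step opens a block /ₑ that is emptied box by box by
-- C-steps and a final □L (the N-rule replaces the block when n = 0).

module Submission where

open import Data.Bool using (Bool; true; false; not; T)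
open import Data.Bool.Properties using (T-≡; T-∧; T-∨; T?)
open import Data.Empty using (⊥-elim)
open import Data.List using (List; []; _∷_; [_]; _++_; map)
open import Data.List.Membership.Propositional using (_∈_; find)
open import Data.List.Membership.Propositional.Properties using (∈-++⁺ˡ; ∈-++⁺ʳ; ∈-++⁻; ∈-∃++)
open import Data.List.Properties using (++-identityʳ; map-++)
open import Data.List.Relation.Binary.Permutation.Propositional
  using (_↭_; ↭-refl; ↭-sym; ↭-trans; ↭-reflexive; prep; swap)
open import Data.List.Relation.Binary.Permutation.Propositional.Properties as Perm using (shift)
open import Data.List.Relation.Binary.Subset.Propositional using (_⊆_)
open import Data.List.Relation.Binary.Subset.Propositional.Properties as Sub
  using (⊆-refl; ⊆-trans; ⊆-reflexive-↭; Any-resp-⊆; All-resp-⊇)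
open import Data.List.Relation.Unary.All using (All; []; _∷_; tabulate; lookup)
open import Data.List.Relation.Unary.All.Properties as All using ()
open import Data.List.Relation.Unary.Any using (Any; here; there; tail)
open import Data.List.Relation.Unary.Any.Properties as Any using ()
open import Data.Nat using (ℕ; suc; _+_; _<_; s≤s; z<s) renaming (_≟_ to _≟ℕ_)
open import Data.Nat.ListAction using (sum)
open import Data.Nat.ListAction.Properties using (sum-++; sum-↭)
open import Data.Nat.Properties
  using (+-identityʳ; +-assoc; n<1+n; m≤m+n; m≤n+m; +-monoˡ-<; <-≤-trans; ≤-pred;
         +-commutativeSemigroup; module ≤-Reasoning)
open import Algebra.Properties.CommutativeSemigroup +-commutativeSemigroup using (interchange; x∙yz≈y∙xz)
open import Data.Product using (_×_; _,_; proj₁; proj₂; ∃)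
open import Data.Sum using (inj₁; inj₂; [_,_]′)
open import Data.Tree.Binary using (Tree; leaf; node)
open import Data.Unit using (⊤; tt)
open import Function using (_∘_; id)
open import Function.Bundles using (Equivalence)
open import Relation.Binary.Definitions using (DecidableEquality)
open import Relation.Binary.PropositionalEquality
  using (_≡_; _≢_; refl; sym; trans; cong; cong₂; subst)
open import Relation.Nullary using (¬_; yes; no; contradiction)
open import Relation.Nullary.Decidable using (map′; _×-dec_; isYes; toWitness; fromWitness)

open import Defs

open Equivalence using (to; from)

module _ {a} {A : Set a} where

  ⊆-∷-prefix : ∀ L {x : A} {xs ys} → ys ⊆ x ∷ xs → L ++ ys ⊆ x ∷ L ++ xs
  ⊆-∷-prefix L {x} {xs} ys⊆x∷xs = ⊆-trans (Sub.++⁺ʳ L ys⊆x∷xs) (⊆-reflexive-↭ (shift x L xs))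

  ++-swap-⊆ : ∀ (L L' xs : List A) → L ++ L' ++ xs ⊆ L' ++ L ++ xs
  ++-swap-⊆ L L' xs = ⊆-reflexive-↭ (↭-trans (↭-sym (Perm.++-assoc L L' xs))
    (↭-trans (Perm.++⁺ʳ xs (Perm.++-comm L L')) (Perm.++-assoc L' L xs)))

  ++-dup-⊆ : ∀ (L xs : List A) → L ++ L ++ xs ⊆ L ++ xs
  ++-dup-⊆ L xs = [ ∈-++⁺ˡ , id ]′ ∘ ∈-++⁻ L

  ∈⇒↭-front : ∀ {x : A} {xs} → x ∈ xs → ∃ λ ys → xs ↭ x ∷ ys
  ∈⇒↭-front x∈xs with ys , zs , refl ← ∈-∃++ x∈xs = ys ++ zs , shift _ ys zs

private
  encode : Fm → Tree ℕ ℕ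
  encode (var p)  = leaf p
  encode ⊥'       = node (leaf 0) 0 (leaf 0)
  encode ⊤'       = node (leaf 0) 1 (leaf 0)
  encode (¬' A)   = node (encode A) 2 (leaf 0)
  encode (A ∧' B) = node (encode A) 3 (encode B)
  encode (A ∨' B) = node (encode A) 4 (encode B)
  encode (A ⊃ B)  = node (encode A) 5 (encode B)
  encode (□ A)    = node (encode A) 6 (leaf 0)

  decode : Tree ℕ ℕ → Fm
  decode (leaf p)     = var p
  decode (node t 0 u) = ⊥'
  decode (node t 1 u) = ⊤'
  decode (node t 2 u) = ¬' decode t
  decode (node t 3 u) = decode t ∧' decode u
  decode (node t 4 u) = decode t ∨' decode u
  decode (node t 5 u) = decode t ⊃ decode u
  decode (node t 6 u) = □ decode t
  decode (node t _ u) = ⊥'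

  decode-encode : ∀ A → decode (encode A) ≡ A
  decode-encode (var p)  = refl
  decode-encode ⊥'       = refl
  decode-encode ⊤'       = refl
  decode-encode (¬' A)   = cong ¬'_ (decode-encode A)
  decode-encode (A ∧' B) = cong₂ _∧'_ (decode-encode A) (decode-encode B)
  decode-encode (A ∨' B) = cong₂ _∨'_ (decode-encode A) (decode-encode B)
  decode-encode (A ⊃ B)  = cong₂ _⊃_ (decode-encode A) (decode-encode B)
  decode-encode (□ A)    = cong □_ (decode-encode A)

  encode-injective : ∀ {A B} → encode A ≡ encode B → A ≡ B
  encode-injective {A} {B} e =
    trans (sym (decode-encode A)) (trans (cong decode e) (decode-encode B))

  _≟ᵀ_ : DecidableEquality (Tree ℕ ℕ)
  leaf p ≟ᵀ leaf q = map′ (cong leaf) (λ { refl → refl }) (p ≟ℕ q)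
  node t m u ≟ᵀ node t' m' u' =
    map′ (λ { (refl , refl , refl) → refl }) (λ { refl → refl , refl , refl })
         (t ≟ᵀ t' ×-dec m ≟ℕ m' ×-dec u ≟ᵀ u')
  leaf _ ≟ᵀ node _ _ _ = no λ ()
  node _ _ _ ≟ᵀ leaf _ = no λ ()

_≟_ : DecidableEquality Fm
A ≟ B = map′ encode-injective (cong encode) (encode A ≟ᵀ encode B)

open import Data.List.Membership.DecPropositional _≟_ using (_∈?_)

Holds : (Fm → Bool) → Fm → Set
Holds v A = T (⟦ A ⟧ v)

Valid : List Fm → List Fm → Set
Valid Γ Δ = ∀ v → All (Holds v) Γ → Any (Holds v) Δ

Valid-mono : ∀ {Γ Δ Γ' Δ'} → Γ ⊆ Γ' → Δ ⊆ Δ' → Valid Γ Δ → Valid Γ' Δ'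
Valid-mono Γ⊆Γ' Δ⊆Δ' valid v hΓ' = Any-resp-⊆ Δ⊆Δ' (valid v (All-resp-⊇ Γ⊆Γ' hΓ'))

T-not : ∀ {b} → T (not b) → ¬ T b
T-not {true} ()

¬T-not : ∀ {b} → ¬ T (not b) → T b
¬T-not {true}  _ = tt
¬T-not {false} n = n tt

-- The premiss (L , R) of the rule for a principal formula stands for L ++ Γ ⇒ R ++ Δ.
Premisses : Set
Premisses = List (List Fm × List Fm)

data LeftRule : Fm → Premisses → Set where
  ⊥L : LeftRule ⊥' []
  ⊤L : LeftRule ⊤' [ [] , [] ]
  ¬L : ∀ {A} → LeftRule (¬' A) [ [] , [ A ] ]
  ∧L : ∀ {A B} → LeftRule (A ∧' B) [ A ∷ B ∷ [] , [] ]
  ∨L : ∀ {A B} → LeftRule (A ∨' B) (([ A ] , []) ∷ ([ B ] , []) ∷ [])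
  ⊃L : ∀ {A B} → LeftRule (A ⊃ B) (([] , [ A ]) ∷ ([ B ] , []) ∷ [])

data RightRule : Fm → Premisses → Set where
  ⊥R : RightRule ⊥' [ [] , [] ]
  ⊤R : RightRule ⊤' []
  ¬R : ∀ {A} → RightRule (¬' A) [ [ A ] , [] ]
  ∧R : ∀ {A B} → RightRule (A ∧' B) (([] , [ A ]) ∷ ([] , [ B ]) ∷ [])
  ∨R : ∀ {A B} → RightRule (A ∨' B) [ [] , A ∷ B ∷ [] ]
  ⊃R : ∀ {A B} → RightRule (A ⊃ B) [ [ A ] , [ B ] ]

data Literal : Fm → Set where
  var : ∀ {p} → Literal (var p)
  box : ∀ {A} → Literal (□ A)

LeftRule-functional : ∀ {X ps qs} → LeftRule X ps → LeftRule X qs → ps ≡ qs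
LeftRule-functional ⊥L ⊥L = refl
LeftRule-functional ⊤L ⊤L = refl
LeftRule-functional ¬L ¬L = refl
LeftRule-functional ∧L ∧L = refl
LeftRule-functional ∨L ∨L = refl
LeftRule-functional ⊃L ⊃L = refl

RightRule-functional : ∀ {X ps qs} → RightRule X ps → RightRule X qs → ps ≡ qs
RightRule-functional ⊥R ⊥R = refl
RightRule-functional ⊤R ⊤R = refl
RightRule-functional ¬R ¬R = refl
RightRule-functional ∧R ∧R = refl
RightRule-functional ∨R ∨R = refl
RightRule-functional ⊃R ⊃R = refl

Literal-≢ˡ : ∀ {Y X ps} → Literal Y → LeftRule X ps → Y ≢ X
Literal-≢ˡ var () refl
Literal-≢ˡ box () refl

Literal-≢ʳ : ∀ {Y X ps} → Literal Y → RightRule X ps → Y ≢ X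
Literal-≢ʳ var () refl
Literal-≢ʳ box () refl

data Shape : Fm → Set where
  literal  : ∀ {A} → Literal A → Shape A
  compound : ∀ {A ps qs} → LeftRule A ps → RightRule A qs → Shape A

shape : ∀ A → Shape A
shape (var p)  = literal var
shape ⊥'       = compound ⊥L ⊥R
shape ⊤'       = compound ⊤L ⊤R
shape (¬' A)   = compound ¬L ¬R
shape (A ∧' B) = compound ∧L ∧R
shape (A ∨' B) = compound ∨L ∨R
shape (A ⊃ B)  = compound ⊃L ⊃R
shape (□ A)    = literal box

data Decomposition (Γ : List Fm) : Set where
  literals : All Literal Γ → Decomposition Γ
  compound : ∀ {X ps qs} Γ₀ → Γ ↭ X ∷ Γ₀ → LeftRule X ps → RightRule X qs → Decomposition Γ

decompose : ∀ Γ → Decomposition Γ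
decompose [] = literals []
decompose (A ∷ Γ) with shape A
... | compound l r = compound Γ ↭-refl l r
... | literal lit with decompose Γ
...   | literals lits = literals (lit ∷ lits)
...   | compound {X} Γ₀ Γ↭ l r = compound (A ∷ Γ₀) (↭-trans (prep A Γ↭) (swap A X ↭-refl)) l r

membership : List Fm → Fm → Bool
membership Γ A = isYes (A ∈? Γ)

Literal-holds : ∀ {v A} → Literal A → T (v A) → Holds v A
Literal-holds var h = h
Literal-holds box h = h

Literal-holds⁻ : ∀ {v A} → Literal A → Holds v A → T (v A)
Literal-holds⁻ var h = h
Literal-holds⁻ box h = h

LeftRule-sound : ∀ {X ps L R} → LeftRule X ps → (L , R) ∈ ps →
                 ∀ v → All (Holds v) L → ¬ Holds v X → Any (Holds v) R
LeftRule-sound ⊤L (here refl) v _ ¬⊤ = ⊥-elim (¬⊤ tt)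
LeftRule-sound ¬L (here refl) v _ ¬¬A = here (¬T-not ¬¬A)
LeftRule-sound ∧L (here refl) v (hA ∷ hB ∷ []) ¬A∧B = ⊥-elim (¬A∧B (from T-∧ (hA , hB)))
LeftRule-sound ∨L (here refl) v (hA ∷ []) ¬A∨B = ⊥-elim (¬A∨B (from T-∨ (inj₁ hA)))
LeftRule-sound ∨L (there (here refl)) v (hB ∷ []) ¬A∨B = ⊥-elim (¬A∨B (from T-∨ (inj₂ hB)))
LeftRule-sound ⊃L (here refl) v _ ¬A⊃B = here (¬T-not λ h¬A → ¬A⊃B (from T-∨ (inj₁ h¬A)))
LeftRule-sound ⊃L (there (here refl)) v (hB ∷ []) ¬A⊃B = ⊥-elim (¬A⊃B (from T-∨ (inj₂ hB)))

RightRule-sound : ∀ {X ps L R} → RightRule X ps → (L , R) ∈ ps →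
                  ∀ v → All (Holds v) L → Holds v X → Any (Holds v) R
RightRule-sound ¬R (here refl) v (hA ∷ []) h¬A = ⊥-elim (T-not h¬A hA)
RightRule-sound ∧R (here refl) v _ hA∧B = here (proj₁ (to T-∧ hA∧B))
RightRule-sound ∧R (there (here refl)) v _ hA∧B = here (proj₂ (to T-∧ hA∧B))
RightRule-sound ∨R (here refl) v _ hA∨B with to T-∨ hA∨B
... | inj₁ hA = here hA
... | inj₂ hB = there (here hB)
RightRule-sound ⊃R (here refl) v (hA ∷ []) hA⊃B with to T-∨ hA⊃B
... | inj₁ h¬A = ⊥-elim (T-not h¬A hA)
... | inj₂ hB = here hB

leftPremiss-valid : ∀ {X ps L R Γ Δ} → LeftRule X ps → (L , R) ∈ ps →
                    Valid (X ∷ Γ) Δ → Valid (L ++ Γ) (R ++ Δ)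
leftPremiss-valid {X} {L = L} {R} rule premiss valid v hLΓ with All.++⁻ L hLΓ | T? (⟦ X ⟧ v)
... | _  , hΓ | yes hX = Any.++⁺ʳ R (valid v (hX ∷ hΓ))
... | hL , _  | no ¬hX = Any.++⁺ˡ (LeftRule-sound rule premiss v hL ¬hX)

rightPremiss-valid : ∀ {X ps L R Γ Δ} → RightRule X ps → (L , R) ∈ ps →
                     Valid Γ (X ∷ Δ) → Valid (L ++ Γ) (R ++ Δ)
rightPremiss-valid {L = L} {R} rule premiss valid v hLΓ with All.++⁻ L hLΓ
... | hL , hΓ with valid v hΓ
...   | here hX = Any.++⁺ˡ (RightRule-sound rule premiss v hL hX)
...   | there hΔ = Any.++⁺ʳ R hΔ

weight : Fm → ℕ
weight (var _)  = 0
weight ⊥'       = 1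
weight ⊤'       = 1
weight (¬' A)   = suc (weight A)
weight (A ∧' B) = suc (weight A + weight B)
weight (A ∨' B) = suc (weight A + weight B)
weight (A ⊃ B)  = suc (weight A + weight B)
weight (□ _)    = 0

weights : List Fm → ℕ
weights Γ = sum (map weight Γ)

weights-++ : ∀ Γ Δ → weights (Γ ++ Δ) ≡ weights Γ + weights Δ
weights-++ Γ Δ = trans (cong sum (map-++ weight Γ Δ)) (sum-++ (map weight Γ) (map weight Δ))

weights-↭ : ∀ {Γ Δ} → Γ ↭ Δ → weights Γ ≡ weights Δ
weights-↭ p = sum-↭ (Perm.map⁺ weight p)

LeftRule-weight : ∀ {X ps L R} → LeftRule X ps → (L , R) ∈ ps → weights L + weights R < weight X
LeftRule-weight ⊤L (here refl) = z<s
LeftRule-weight (¬L {A}) (here refl)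
  rewrite +-identityʳ (weight A) = n<1+n (weight A)
LeftRule-weight (∧L {A} {B}) (here refl)
  rewrite +-identityʳ (weight B) | +-identityʳ (weight A + weight B) = n<1+n (weight A + weight B)
LeftRule-weight (∨L {A} {B}) (here refl)
  rewrite +-identityʳ (weight A) | +-identityʳ (weight A) = s≤s (m≤m+n (weight A) (weight B))
LeftRule-weight (∨L {A} {B}) (there (here refl))
  rewrite +-identityʳ (weight B) | +-identityʳ (weight B) = s≤s (m≤n+m (weight B) (weight A))
LeftRule-weight (⊃L {A} {B}) (here refl)
  rewrite +-identityʳ (weight A) = s≤s (m≤m+n (weight A) (weight B))
LeftRule-weight (⊃L {A} {B}) (there (here refl))
  rewrite +-identityʳ (weight B) | +-identityʳ (weight B) = s≤s (m≤n+m (weight B) (weight A))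

RightRule-weight : ∀ {X ps L R} → RightRule X ps → (L , R) ∈ ps → weights L + weights R < weight X
RightRule-weight ⊥R (here refl) = z<s
RightRule-weight (¬R {A}) (here refl)
  rewrite +-identityʳ (weight A) | +-identityʳ (weight A) = n<1+n (weight A)
RightRule-weight (∧R {A} {B}) (here refl)
  rewrite +-identityʳ (weight A) = s≤s (m≤m+n (weight A) (weight B))
RightRule-weight (∧R {A} {B}) (there (here refl))
  rewrite +-identityʳ (weight B) = s≤s (m≤n+m (weight B) (weight A))
RightRule-weight (∨R {A} {B}) (here refl)
  rewrite +-identityʳ (weight B) = n<1+n (weight A + weight B)
RightRule-weight (⊃R {A} {B}) (here refl)
  rewrite +-identityʳ (weight A) | +-identityʳ (weight B) = n<1+n (weight A + weight B)

interchange-< : ∀ {a b c} d e → a + b < c → (a + d) + (b + e) < c + (d + e)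
interchange-< {a} {b} {c} d e a+b<c = begin-strict
  (a + d) + (b + e) ≡⟨ interchange a d b e ⟩
  (a + b) + (d + e) <⟨ +-monoˡ-< (d + e) a+b<c ⟩
  c + (d + e)       ∎
  where open ≤-Reasoning

leftPremiss-lighter : ∀ {X ps L R Γ Γ₀ Δ} → LeftRule X ps → (L , R) ∈ ps → Γ ↭ X ∷ Γ₀ →
                      weights (L ++ Γ₀) + weights (R ++ Δ) < weights Γ + weights Δ
leftPremiss-lighter {X} {L = L} {R} {Γ} {Γ₀} {Δ} rule q Γ↭ = begin-strict
  weights (L ++ Γ₀) + weights (R ++ Δ)
    ≡⟨ cong₂ _+_ (weights-++ L Γ₀) (weights-++ R Δ) ⟩
  (weights L + weights Γ₀) + (weights R + weights Δ)
    <⟨ interchange-< {weights L} {weights R} _ _ (LeftRule-weight rule q) ⟩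
  weight X + (weights Γ₀ + weights Δ)
    ≡⟨ +-assoc (weight X) _ _ ⟨
  weights (X ∷ Γ₀) + weights Δ
    ≡⟨ cong (_+ weights Δ) (weights-↭ Γ↭) ⟨
  weights Γ + weights Δ
    ∎
  where open ≤-Reasoning

rightPremiss-lighter : ∀ {X ps L R Γ Δ Δ₀} → RightRule X ps → (L , R) ∈ ps → Δ ↭ X ∷ Δ₀ →
                       weights (L ++ Γ) + weights (R ++ Δ₀) < weights Γ + weights Δ
rightPremiss-lighter {X} {L = L} {R} {Γ} {Δ} {Δ₀} rule q Δ↭ = begin-strict
  weights (L ++ Γ) + weights (R ++ Δ₀)
    ≡⟨ cong₂ _+_ (weights-++ L Γ) (weights-++ R Δ₀) ⟩
  (weights L + weights Γ) + (weights R + weights Δ₀)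
    <⟨ interchange-< {weights L} {weights R} _ _ (RightRule-weight rule q) ⟩
  weight X + (weights Γ + weights Δ₀)
    ≡⟨ x∙yz≈y∙xz (weight X) (weights Γ) (weights Δ₀) ⟩
  weights Γ + weights (X ∷ Δ₀)
    ≡⟨ cong (weights Γ +_) (weights-↭ Δ↭) ⟨
  weights Γ + weights Δ
    ∎
  where open ≤-Reasoning

module _ (𝒜 : Axioms) where

  ArityOk : List Fm → Set
  ArityOk []          = hasN 𝒜 ≡ true
  ArityOk (_ ∷ [])    = ⊤
  ArityOk (_ ∷ _ ∷ _) = hasC 𝒜 ≡ true

  infix 4 _□⊆_
  _□⊆_ : List Fm → List Fm → Set
  As □⊆ Γ = ∀ {A} → A ∈ As → □ A ∈ Γ

  -- Contexts are lists read as sets (⊩-mono makes weakening and contraction admissible),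
  -- and the principal formula of a propositional rule stays in its premisses.
  infix 3 _⊩_
  data _⊩_ : List Fm → List Fm → Set

  Converse : List Fm → Fm → Set
  Converse As B = hasM 𝒜 ≡ false → ∀ {A} → A ∈ As → [ B ] ⊩ [ A ]

  data _⊩_ where
    init  : ∀ {Γ Δ p} → var p ∈ Γ → var p ∈ Δ → Γ ⊩ Δ
    left  : ∀ {Γ Δ X ps} → X ∈ Γ → LeftRule X ps →
            (∀ {L R} → (L , R) ∈ ps → L ++ Γ ⊩ R ++ Δ) → Γ ⊩ Δ
    right : ∀ {Γ Δ X ps} → X ∈ Δ → RightRule X ps →
            (∀ {L R} → (L , R) ∈ ps → L ++ Γ ⊩ R ++ Δ) → Γ ⊩ Δ
    box   : ∀ {Γ Δ B} As → □ B ∈ Δ → As □⊆ Γ → ArityOk As → As ⊩ [ B ] →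
            Converse As B → Γ ⊩ Δ

  ArityOk-nonempty : hasC 𝒜 ≡ true → ∀ A As → ArityOk (A ∷ As)
  ArityOk-nonempty C A []      = tt
  ArityOk-nonempty C A (_ ∷ _) = C

  ArityOk-++ : hasC 𝒜 ≡ true → ∀ As Bs → ArityOk As → ArityOk (As ++ Bs)
  ArityOk-++ C []       []       N = N
  ArityOk-++ C []       (B ∷ Bs) _ = ArityOk-nonempty C B Bs
  ArityOk-++ C (A ∷ As) Bs       _ = ArityOk-nonempty C A (As ++ Bs)

  ArityOk-unary : ∀ {A As} → hasC 𝒜 ≡ false → ArityOk As → A ∈ As → As ≡ [ A ]
  ArityOk-unary {As = _ ∷ []} _ _ (here refl) = refl
  ArityOk-unary {As = _ ∷ _ ∷ _} ¬C C _ with trans (sym C) ¬C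
  ... | ()

  ⊩-mono : ∀ {Γ Δ Γ' Δ'} → Γ ⊆ Γ' → Δ ⊆ Δ' → Γ ⊩ Δ → Γ' ⊩ Δ'
  ⊩-mono s t (init a b) = init (s a) (t b)
  ⊩-mono s t (left m rule ds) =
    left (s m) rule λ {L} {R} q → ⊩-mono (Sub.++⁺ʳ L s) (Sub.++⁺ʳ R t) (ds q)
  ⊩-mono s t (right m rule ds) =
    right (t m) rule λ {L} {R} q → ⊩-mono (Sub.++⁺ʳ L s) (Sub.++⁺ʳ R t) (ds q)
  ⊩-mono s t (box As m g ok d c) = box As (t m) (s ∘ g) ok d c

  ⊩-swap-prefixes : ∀ L L' R R' {Γ Δ} → L ++ L' ++ Γ ⊩ R ++ R' ++ Δ → L' ++ L ++ Γ ⊩ R' ++ R ++ Δ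
  ⊩-swap-prefixes L L' R R' {Γ} {Δ} = ⊩-mono (++-swap-⊆ L L' Γ) (++-swap-⊆ R R' Δ)

  ⊩-contract-prefixes : ∀ L R {Γ Δ} → L ++ L ++ Γ ⊩ R ++ R ++ Δ → L ++ Γ ⊩ R ++ Δ
  ⊩-contract-prefixes L R {Γ} {Δ} = ⊩-mono (++-dup-⊆ L Γ) (++-dup-⊆ R Δ)

  ⊩-invertˡ-⊆ : ∀ {X ps L R Γ Δ Γ' Δ'} → LeftRule X ps → (L , R) ∈ ps →
                Γ' ⊆ X ∷ Γ → Δ' ⊆ Δ → Γ' ⊩ Δ' → L ++ Γ ⊩ R ++ Δ
  ⊩-invertˡ-⊆ {L = L} {R} rule _ s t (init a b) =
    init (∈-++⁺ʳ L (tail (Literal-≢ˡ var rule) (s a))) (∈-++⁺ʳ R (t b))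
  ⊩-invertˡ-⊆ {L = L} {R} rule q s t (left m rule' ds) with s m
  ... | here refl rewrite LeftRule-functional rule' rule =
    ⊩-contract-prefixes L R (⊩-invertˡ-⊆ rule q (⊆-∷-prefix L s) (Sub.++⁺ʳ R t) (ds q))
  ... | there m' = left (∈-++⁺ʳ L m') rule' λ {L'} {R'} q' →
    ⊩-swap-prefixes L L' R R' (⊩-invertˡ-⊆ rule q (⊆-∷-prefix L' s) (Sub.++⁺ʳ R' t) (ds q'))
  ⊩-invertˡ-⊆ {L = L} {R} rule q s t (right m rule' ds) = right (∈-++⁺ʳ R (t m)) rule' λ {L'} {R'} q' →
    ⊩-swap-prefixes L L' R R' (⊩-invertˡ-⊆ rule q (⊆-∷-prefix L' s) (Sub.++⁺ʳ R' t) (ds q'))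
  ⊩-invertˡ-⊆ {L = L} {R} rule _ s t (box As m g ok d c) =
    box As (∈-++⁺ʳ R (t m)) (∈-++⁺ʳ L ∘ tail (Literal-≢ˡ box rule) ∘ s ∘ g) ok d c

  ⊩-invertʳ-⊆ : ∀ {X ps L R Γ Δ Γ' Δ'} → RightRule X ps → (L , R) ∈ ps →
                Γ' ⊆ Γ → Δ' ⊆ X ∷ Δ → Γ' ⊩ Δ' → L ++ Γ ⊩ R ++ Δ
  ⊩-invertʳ-⊆ {L = L} {R} rule _ s t (init a b) =
    init (∈-++⁺ʳ L (s a)) (∈-++⁺ʳ R (tail (Literal-≢ʳ var rule) (t b)))
  ⊩-invertʳ-⊆ {L = L} {R} rule q s t (right m rule' ds) with t m
  ... | here refl rewrite RightRule-functional rule' rule =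
    ⊩-contract-prefixes L R (⊩-invertʳ-⊆ rule q (Sub.++⁺ʳ L s) (⊆-∷-prefix R t) (ds q))
  ... | there m' = right (∈-++⁺ʳ R m') rule' λ {L'} {R'} q' →
    ⊩-swap-prefixes L L' R R' (⊩-invertʳ-⊆ rule q (Sub.++⁺ʳ L' s) (⊆-∷-prefix R' t) (ds q'))
  ⊩-invertʳ-⊆ {L = L} {R} rule q s t (left m rule' ds) = left (∈-++⁺ʳ L (s m)) rule' λ {L'} {R'} q' →
    ⊩-swap-prefixes L L' R R' (⊩-invertʳ-⊆ rule q (Sub.++⁺ʳ L' s) (⊆-∷-prefix R' t) (ds q'))
  ⊩-invertʳ-⊆ {L = L} {R} rule _ s t (box As m g ok d c) =
    box As (∈-++⁺ʳ R (tail (Literal-≢ʳ box rule) (t m))) (∈-++⁺ʳ L ∘ s ∘ g) ok d c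

  ⊩-invertˡ : ∀ {X ps L R Γ Δ} → LeftRule X ps → (L , R) ∈ ps → X ∷ Γ ⊩ Δ → L ++ Γ ⊩ R ++ Δ
  ⊩-invertˡ rule q = ⊩-invertˡ-⊆ rule q ⊆-refl ⊆-refl

  ⊩-invertʳ : ∀ {X ps L R Γ Δ} → RightRule X ps → (L , R) ∈ ps → Γ ⊩ X ∷ Δ → L ++ Γ ⊩ R ++ Δ
  ⊩-invertʳ rule q = ⊩-invertʳ-⊆ rule q ⊆-refl ⊆-refl

  ⊩-weaken-under : ∀ {C Γ Δ} L R → C ∷ Γ ⊩ Δ → C ∷ L ++ Γ ⊩ R ++ Δ
  ⊩-weaken-under {C} {Γ} {Δ} L R = ⊩-mono (Sub.∷⁺ʳ C (Sub.xs⊆ys++xs Γ L)) (Sub.xs⊆ys++xs Δ R)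

  cut-var : ∀ {p Γ Δ Γ' Δ'} → Γ' ⊆ Γ → Δ' ⊆ var p ∷ Δ → Γ' ⊩ Δ' → var p ∷ Γ ⊩ Δ → Γ ⊩ Δ
  cut-var s t (init a b) e with t b
  ... | here refl = ⊩-mono (Sub.∈-∷⁺ʳ (s a) ⊆-refl) ⊆-refl e
  ... | there b'  = init (s a) b'
  cut-var s t (left m rule ds) e = left (s m) rule λ {L} {R} q →
    cut-var (Sub.++⁺ʳ L s) (⊆-∷-prefix R t) (ds q) (⊩-weaken-under L R e)
  cut-var s t (right m rule ds) e =
    right (tail (Literal-≢ʳ var rule ∘ sym) (t m)) rule λ {L} {R} q →
    cut-var (Sub.++⁺ʳ L s) (⊆-∷-prefix R t) (ds q) (⊩-weaken-under L R e)
  cut-var s t (box As m g ok d c) e = box As (tail (λ ()) (t m)) (s ∘ g) ok d c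

  module BoxCut (D : Fm) (cut-D : ∀ {Γ Δ} → Γ ⊩ D ∷ Δ → D ∷ Γ ⊩ Δ → Γ ⊩ Δ) where

    cut-D-single : ∀ {A B} → [ A ] ⊩ [ D ] → [ D ] ⊩ [ B ] → [ A ] ⊩ [ B ]
    cut-D-single d e = cut-D (⊩-mono ⊆-refl (Sub.∷⁺ʳ D λ ()) d) (⊩-mono (Sub.∷⁺ʳ D λ ()) ⊆-refl e)

    data Split (Γ As : List Fm) : Set where
      none : As □⊆ Γ → Split Γ As
      some : D ∈ As → (Bs : List Fm) → Bs □⊆ Γ → As ⊆ D ∷ Bs → Bs ⊆ As → Split Γ As

    split : ∀ {Γ} As → As □⊆ □ D ∷ Γ → Split Γ As
    split [] _ = none λ ()
    split (A ∷ As) f with f (here refl) | split As (f ∘ there)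
    ... | here refl | none g            = some (here refl) As g ⊆-refl there
    ... | here refl | some _ Bs g s₁ s₂ =
      some (here refl) Bs g (Sub.∈-∷⁺ʳ (here refl) s₁) (there ∘ s₂)
    ... | there □A∈ | none g            = none λ { (here refl) → □A∈ ; (there a) → g a }
    ... | there □A∈ | some D∈ Bs g s₁ s₂ =
      some (there D∈) (A ∷ Bs) (λ { (here refl) → □A∈ ; (there a) → g a })
           (Sub.∈-∷⁺ʳ (there (here refl)) (⊆-trans s₁ (Sub.∷⁺ʳ D (Sub.xs⊆x∷xs Bs A))))
           (Sub.∷⁺ʳ A s₂)

    merge : ∀ {Γ Δ E As'} As Bs → As □⊆ Γ → Bs □⊆ Γ → ArityOk (As ++ Bs) →
            As ⊩ [ D ] → Converse As D → □ E ∈ Δ → As' ⊩ [ E ] → Converse As' E →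
            D ∈ As' → As' ⊆ D ∷ Bs → Bs ⊆ As' → Γ ⊩ Δ
    merge {E = E} As Bs g h ok d c □E∈ d' c' D∈ s₁ s₂ =
      box (As ++ Bs) □E∈ ([ g , h ]′ ∘ ∈-++⁻ As) ok premiss converse
      where
      premiss : As ++ Bs ⊩ [ E ]
      premiss = cut-D (⊩-mono (Sub.xs⊆xs++ys As Bs) (Sub.∷⁺ʳ D λ ()) d)
                      (⊩-mono (⊆-trans s₁ (Sub.∷⁺ʳ D (Sub.xs⊆ys++xs Bs As))) ⊆-refl d')

      converse : Converse (As ++ Bs) E
      converse ¬M a with ∈-++⁻ As a
      ... | inj₁ a∈As = cut-D-single (c' ¬M D∈) (c ¬M a∈As)
      ... | inj₂ a∈Bs = c' ¬M (s₂ a∈Bs)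

    cut-right : ∀ {Γ Δ Γ' Δ'} As → As □⊆ Γ → ArityOk As → As ⊩ [ D ] → Converse As D →
                Γ' ⊆ □ D ∷ Γ → Δ' ⊆ Δ → Γ' ⊩ Δ' → Γ ⊩ Δ
    cut-right As g ok d c s t (init a b) = init (tail (λ ()) (s a)) (t b)
    cut-right As g ok d c s t (left m rule es) =
      left (tail (Literal-≢ˡ box rule ∘ sym) (s m)) rule λ {L} {R} q →
      cut-right As (∈-++⁺ʳ L ∘ g) ok d c (⊆-∷-prefix L s) (Sub.++⁺ʳ R t) (es q)
    cut-right As g ok d c s t (right m rule es) = right (t m) rule λ {L} {R} q →
      cut-right As (∈-++⁺ʳ L ∘ g) ok d c (⊆-∷-prefix L s) (Sub.++⁺ʳ R t) (es q)
    cut-right As g ok d c s t (box As' m g' ok' d' c') with split As' (s ∘ g') | hasC 𝒜 in hasC≡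
    ... | none h               | _     = box As' (t m) h ok' d' c'
    ... | some D∈ Bs h s₁ s₂   | true  =
      merge As Bs g h (ArityOk-++ hasC≡ As Bs ok) d c (t m) d' c' D∈ s₁ s₂
    ... | some D∈ _ _ _ _      | false =  -- without C the box context As' is [ D ]
      merge As [] g (λ ()) (subst ArityOk (sym (++-identityʳ As)) ok) d c (t m) d' c' D∈
            (Sub.⊆-reflexive (ArityOk-unary hasC≡ ok' D∈)) λ ()

    cut-left : ∀ {Γ Δ Γ' Δ'} → Γ' ⊆ Γ → Δ' ⊆ □ D ∷ Δ → Γ' ⊩ Δ' → □ D ∷ Γ ⊩ Δ → Γ ⊩ Δ
    cut-left s t (init a b) e = init (s a) (tail (λ ()) (t b))
    cut-left s t (left m rule ds) e = left (s m) rule λ {L} {R} q →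
      cut-left (Sub.++⁺ʳ L s) (⊆-∷-prefix R t) (ds q) (⊩-weaken-under L R e)
    cut-left s t (right m rule ds) e =
      right (tail (Literal-≢ʳ box rule ∘ sym) (t m)) rule λ {L} {R} q →
      cut-left (Sub.++⁺ʳ L s) (⊆-∷-prefix R t) (ds q) (⊩-weaken-under L R e)
    cut-left s t (box As m g ok d c) e with t m
    ... | here refl = cut-right As (s ∘ g) ok d c ⊆-refl ⊆-refl e
    ... | there m'  = box As m' (s ∘ g) ok d c

  cut : ∀ C {Γ Δ} → Γ ⊩ C ∷ Δ → C ∷ Γ ⊩ Δ → Γ ⊩ Δ
  cut (var p) = cut-var ⊆-refl ⊆-refl
  cut ⊥' d _ = ⊩-invertʳ ⊥R (here refl) d
  cut ⊤' _ e = ⊩-invertˡ ⊤L (here refl) e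
  cut (¬' A) d e = cut A (⊩-invertˡ ¬L (here refl) e) (⊩-invertʳ ¬R (here refl) d)
  cut (A ∧' B) d e =
    cut A (⊩-invertʳ ∧R (here refl) d)
          (cut B (⊩-mono (Sub.xs⊆x∷xs _ A) ⊆-refl (⊩-invertʳ ∧R (there (here refl)) d))
                 (⊩-mono (⊆-reflexive-↭ (swap A B ↭-refl)) ⊆-refl (⊩-invertˡ ∧L (here refl) e)))
  cut (A ∨' B) d e =
    cut B (cut A (⊩-invertʳ ∨R (here refl) d)
                 (⊩-mono ⊆-refl (Sub.xs⊆x∷xs _ B) (⊩-invertˡ ∨L (here refl) e)))
          (⊩-invertˡ ∨L (there (here refl)) e)
  cut (A ⊃ B) d e =
    cut A (⊩-invertˡ ⊃L (here refl) e)
          (cut B (⊩-invertʳ ⊃R (here refl) d)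
                 (⊩-mono (Sub.∷⁺ʳ B (Sub.xs⊆x∷xs _ A)) ⊆-refl (⊩-invertˡ ⊃L (there (here refl)) e)))
  cut (□ D) = BoxCut.cut-left D (cut D) ⊆-refl ⊆-refl

  ⊩-id : ∀ A {Γ Δ} → A ∈ Γ → A ∈ Δ → Γ ⊩ Δ
  ⊩-id (var p) a b = init a b
  ⊩-id ⊥' a _ = left a ⊥L λ ()
  ⊩-id ⊤' _ b = right b ⊤R λ ()
  ⊩-id (¬' A) a b = right b ¬R λ { (here refl) →
    left (there a) ¬L λ { (here refl) → ⊩-id A (here refl) (here refl) } }
  ⊩-id (A ∧' B) a b = right b ∧R λ
    { (here refl) → left a ∧L λ { (here refl) → ⊩-id A (here refl) (here refl) }
    ; (there (here refl)) → left a ∧L λ { (here refl) → ⊩-id B (there (here refl)) (here refl) } }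
  ⊩-id (A ∨' B) a b = right b ∨R λ { (here refl) → left a ∨L λ
    { (here refl) → ⊩-id A (here refl) (here refl)
    ; (there (here refl)) → ⊩-id B (here refl) (there (here refl)) } }
  ⊩-id (A ⊃ B) a b = right b ⊃R λ { (here refl) → left (there a) ⊃L λ
    { (here refl) → ⊩-id A (here refl) (here refl)
    ; (there (here refl)) → ⊩-id B (here refl) (here refl) } }
  ⊩-id (□ A) a b = box [ A ] b (λ { (here refl) → a }) tt (⊩-id A (here refl) (here refl))
    λ _ → λ { (here refl) → ⊩-id A (here refl) (here refl) }

  ⊩-∧-elimˡ : ∀ {A B} → [ A ∧' B ] ⊩ [ A ]
  ⊩-∧-elimˡ {A} = left (here refl) ∧L λ { (here refl) → ⊩-id A (here refl) (here refl) }

  ⊩-∧-elimʳ : ∀ {A B} → [ A ∧' B ] ⊩ [ B ]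
  ⊩-∧-elimʳ {B = B} =
    left (here refl) ∧L λ { (here refl) → ⊩-id B (there (here refl)) (here refl) }

  ⊩-□-cong : ∀ {A B Γ Δ} → □ A ∈ Γ → □ B ∈ Δ → [ A ] ⊩ [ B ] → [ B ] ⊩ [ A ] → Γ ⊩ Δ
  ⊩-□-cong {A} □A∈ □B∈ d e =
    box [ A ] □B∈ (λ { (here refl) → □A∈ }) tt d λ _ → λ { (here refl) → e }

  ⊩-□-mono : ∀ {A B Γ Δ} → hasM 𝒜 ≡ true → □ A ∈ Γ → □ B ∈ Δ → [ A ] ⊩ [ B ] → Γ ⊩ Δ
  ⊩-□-mono {A} M □A∈ □B∈ d =
    box [ A ] □B∈ (λ { (here refl) → □A∈ }) tt d λ ¬M → contradiction (trans (sym M) ¬M) λ ()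

  ⊩-axM : ∀ {A B} → hasM 𝒜 ≡ true → [] ⊩ [ □ (A ∧' B) ⊃ (□ A ∧' □ B) ]
  ⊩-axM M = right (here refl) ⊃R λ { (here refl) → right (here refl) ∧R λ
    { (here refl) → ⊩-□-mono M (here refl) (here refl) ⊩-∧-elimˡ
    ; (there (here refl)) → ⊩-□-mono M (here refl) (here refl) ⊩-∧-elimʳ } }

  ⊩-axC : ∀ {A B} → hasC 𝒜 ≡ true → [] ⊩ [ (□ A ∧' □ B) ⊃ □ (A ∧' B) ]
  ⊩-axC {A} {B} C = right (here refl) ⊃R λ { (here refl) → left (here refl) ∧L λ { (here refl) →
    box (A ∷ B ∷ []) (here refl)
        (λ { (here refl) → here refl ; (there (here refl)) → there (here refl) }) C
        (right (here refl) ∧R λ { (here refl) → ⊩-id A (here refl) (here refl)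
                                ; (there (here refl)) → ⊩-id B (there (here refl)) (here refl) })
        λ _ → λ { (here refl) → ⊩-∧-elimˡ ; (there (here refl)) → ⊩-∧-elimʳ } } }

  ⊩-axN : hasN 𝒜 ≡ true → [] ⊩ [ □ ⊤' ]
  ⊩-axN N = box [] (here refl) (λ ()) N (right (here refl) ⊤R λ ()) λ _ ()

  -- The valuation `membership Γ` makes all of Γ true, so validity provides a literal of Δ
  -- that lies in Γ.
  literals-complete : ∀ {Γ Δ} → All Literal Γ → All Literal Δ → Valid Γ Δ → Γ ⊩ Δ
  literals-complete {Γ} litΓ litΔ valid
    with find (valid (membership Γ) (tabulate λ A∈Γ → Literal-holds (lookup litΓ A∈Γ) (fromWitness A∈Γ)))
  ... | A , A∈Δ , hA = ⊩-id A (toWitness (Literal-holds⁻ (lookup litΔ A∈Δ) hA)) A∈Δ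

  ⊩-complete-< : ∀ n {Γ Δ} → weights Γ + weights Δ < n → Valid Γ Δ → Γ ⊩ Δ
  ⊩-complete-< (suc n) {Γ} {Δ} bound valid with decompose Γ | decompose Δ
  ... | compound Γ₀ Γ↭ rule _ | _ = left (Γ⊇ (here refl)) rule λ {L} {R} q →
    ⊩-mono (Sub.++⁺ʳ L (Γ⊇ ∘ there)) ⊆-refl
      (⊩-complete-< n (<-≤-trans (leftPremiss-lighter rule q Γ↭) (≤-pred bound))
        (leftPremiss-valid rule q (Valid-mono (⊆-reflexive-↭ Γ↭) ⊆-refl valid)))
    where Γ⊇ = ⊆-reflexive-↭ (↭-sym Γ↭)
  ... | literals _ | compound Δ₀ Δ↭ _ rule = right (Δ⊇ (here refl)) rule λ {L} {R} q →
    ⊩-mono ⊆-refl (Sub.++⁺ʳ R (Δ⊇ ∘ there))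
      (⊩-complete-< n (<-≤-trans (rightPremiss-lighter rule q Δ↭) (≤-pred bound))
        (rightPremiss-valid rule q (Valid-mono ⊆-refl (⊆-reflexive-↭ Δ↭) valid)))
    where Δ⊇ = ⊆-reflexive-↭ (↭-sym Δ↭)
  ... | literals litΓ | literals litΔ = literals-complete litΓ litΔ valid

  ⊩-complete : ∀ {Γ Δ} → Valid Γ Δ → Γ ⊩ Δ
  ⊩-complete = ⊩-complete-< _ (n<1+n _)

  ⊩-imp : ∀ {A B} → [] ⊩ [ A ⊃ B ] → [ A ] ⊩ [ B ]
  ⊩-imp = ⊩-invertʳ ⊃R (here refl)

  E⇒⊩ : ∀ {A} → E 𝒜 ⊢ A → [] ⊩ [ A ]
  E⇒⊩ (taut ⊨A) = ⊩-complete λ v _ → here (from T-≡ (⊨A v))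
  E⇒⊩ (axM M) = ⊩-axM M
  E⇒⊩ (axC C) = ⊩-axC C
  E⇒⊩ (axN N) = ⊩-axN N
  E⇒⊩ (mp {A} ⊢A⊃B ⊢A) = cut A (⊩-mono ⊆-refl (Sub.∷⁺ʳ A λ ()) (E⇒⊩ ⊢A)) (⊩-imp (E⇒⊩ ⊢A⊃B))
  E⇒⊩ (ruleE ⊢A⊃B ⊢B⊃A) = right (here refl) ⊃R λ { (here refl) →
    ⊩-□-cong (here refl) (here refl) (⊩-imp (E⇒⊩ ⊢A⊃B)) (⊩-imp (E⇒⊩ ⊢B⊃A)) }

  ⊲-≈ : ∀ G {X Y} → X ≈ Y → (G ⊲ X) ≈ (G ⊲ Y)
  ⊲-≈ [] X≈Y = X≈Y
  ⊲-≈ (_ ∷ G) X≈Y = cons≈ (↭-refl , ↭-refl) (⊲-≈ G X≈Y)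

  ⊲-snoc : ∀ G s X → ((G ++ [ s ]) ⊲ X) ≡ (G ⊲ (s ∷/ X))
  ⊲-snoc [] s X = refl
  ⊲-snoc (t ∷ G) s X = cong (t ∷/_) (⊲-snoc G s X)

  LNS-snoc : ∀ G s {X} → LNS 𝒜 ⊢ ((G ++ [ s ]) ⊲ X) → LNS 𝒜 ⊢ (G ⊲ (s ∷/ X))
  LNS-snoc G s = subst (LNS 𝒜 ⊢_) (⊲-snoc G s _)

  LNS-perm : ∀ G {Γ Γ' Δ Δ'} → Γ ↭ Γ' → Δ ↭ Δ' →
             LNS 𝒜 ⊢ (G ⊲ seq (Γ ⇒ Δ)) → LNS 𝒜 ⊢ (G ⊲ seq (Γ' ⇒ Δ'))
  LNS-perm G Γ↭ Δ↭ = perm (⊲-≈ G (seq≈ (Γ↭ , Δ↭)))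

  LNS-contract : ∀ G {A Γ Δ} → A ∈ Γ → LNS 𝒜 ⊢ (G ⊲ seq (A ∷ Γ ⇒ Δ)) → LNS 𝒜 ⊢ (G ⊲ seq (Γ ⇒ Δ))
  LNS-contract G {A} A∈Γ d with _ , Γ↭ ← ∈⇒↭-front A∈Γ =
    LNS-perm G (↭-sym Γ↭) ↭-refl (CL {G = G} (LNS-perm G (prep A Γ↭) ↭-refl d))

  LNS-contract-boxes : ∀ G {Γ Δ} As → As □⊆ Γ → LNS 𝒜 ⊢ (G ⊲ seq (map □_ As ++ Γ ⇒ Δ)) →
                       LNS 𝒜 ⊢ (G ⊲ seq (Γ ⇒ Δ))
  LNS-contract-boxes G [] _ d = d
  LNS-contract-boxes G (A ∷ As) g d =
    LNS-contract-boxes G As (g ∘ there) (LNS-contract G (∈-++⁺ʳ (map □_ As) (g (here refl))) d)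

  -- ⊩ keeps the principal formula, so each LNS rule is applied to a copy of it and the
  -- duplicate is contracted.
  LeftRule-LNS : ∀ G {X ps Γ Δ} → LeftRule X ps →
                 (∀ {L R} → (L , R) ∈ ps → LNS 𝒜 ⊢ (G ⊲ seq (L ++ X ∷ Γ ⇒ R ++ Δ))) →
                 LNS 𝒜 ⊢ (G ⊲ seq (X ∷ Γ ⇒ Δ))
  LeftRule-LNS G ⊥L _  = ⊥L {G = G}
  LeftRule-LNS G ⊤L ds = ds (here refl)
  LeftRule-LNS G ¬L ds = CL {G = G} (¬L {G = G} (ds (here refl)))
  LeftRule-LNS G ∧L ds = CL {G = G} (∧L {G = G} (ds (here refl)))
  LeftRule-LNS G ∨L ds = CL {G = G} (∨L {G = G} (ds (here refl)) (ds (there (here refl))))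
  LeftRule-LNS G ⊃L ds = CL {G = G} (⊃L {G = G} (ds (here refl)) (ds (there (here refl))))

  RightRule-LNS : ∀ G {X ps Γ Δ} → RightRule X ps →
                  (∀ {L R} → (L , R) ∈ ps → LNS 𝒜 ⊢ (G ⊲ seq (L ++ Γ ⇒ R ++ X ∷ Δ))) →
                  LNS 𝒜 ⊢ (G ⊲ seq (Γ ⇒ X ∷ Δ))
  RightRule-LNS G ⊥R ds = ds (here refl)
  RightRule-LNS G ⊤R _  = ⊤R {G = G}
  RightRule-LNS G ¬R ds = CR {G = G} (¬R {G = G} (ds (here refl)))
  RightRule-LNS G ∧R ds = CR {G = G} (∧R {G = G} (ds (here refl)) (ds (there (here refl))))
  RightRule-LNS G ∨R ds = CR {G = G} (∨R {G = G} (ds (here refl)))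
  RightRule-LNS G ⊃R ds = CR {G = G} (⊃R {G = G} (ds (here refl)))

  unfold-block : ∀ G {Γ Δ Σ Ω B} A As → ArityOk (A ∷ As) →
                 (∀ G' → LNS 𝒜 ⊢ (G' ⊲ seq (A ∷ As ++ Σ ⇒ [ B ]))) →
                 (∀ G' {C} → C ∈ A ∷ As → LNS 𝒜 ⊢ (G' ⊲ seq (Ω ⇒ [ C ]))) →
                 LNS 𝒜 ⊢ (G ⊲ eblk (map □_ (A ∷ As) ++ Γ ⇒ Δ) (Σ ⇒ [ B ]) (Ω ⇒ []))
  unfold-block G {Γ} {Δ} A [] _ fwd bwd =
    □L {G = G} (LNS-snoc G (Γ ⇒ Δ) (fwd _)) (LNS-snoc G (Γ ⇒ Δ) (bwd _ (here refl)))
  unfold-block G {Γ} {Δ} {Σ} A (A' ∷ As) C fwd bwd =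
    ruleC {G = G} C
      (unfold-block G A' As (ArityOk-nonempty C A' As)
        (λ G' → LNS-perm G' (↭-sym (shift A (A' ∷ As) Σ)) ↭-refl (fwd G')) (λ G' → bwd G' ∘ there))
      (LNS-snoc G (map □_ (A' ∷ As) ++ Γ ⇒ Δ) (bwd _ (here refl)))

  box-LNS : ∀ G {Γ Δ B} As → ArityOk As → (∀ G' → LNS 𝒜 ⊢ (G' ⊲ seq (As ⇒ [ B ]))) →
            (hasM 𝒜 ≡ false → ∀ G' {A} → A ∈ As → LNS 𝒜 ⊢ (G' ⊲ seq ([ B ] ⇒ [ A ]))) →
            LNS 𝒜 ⊢ (G ⊲ seq (map □_ As ++ Γ ⇒ □ B ∷ Δ))
  box-LNS G {Γ} {Δ} [] N fwd _ = ruleN {G = G} N (LNS-snoc G (Γ ⇒ Δ) (fwd _))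
  box-LNS G {Γ} {Δ} {B} (A ∷ As) ok fwd bwd = □R {G = G} (block (hasM 𝒜) refl)
    where
    fwd' : ∀ G' → LNS 𝒜 ⊢ (G' ⊲ seq (A ∷ As ++ [] ⇒ [ B ]))
    fwd' G' = LNS-perm G' (↭-reflexive (sym (++-identityʳ (A ∷ As)))) ↭-refl (fwd G')

    -- Under M, ruleM puts ⊥ into the right sequent of the block, closing every backward premiss.
    block : ∀ m → hasM 𝒜 ≡ m →
            LNS 𝒜 ⊢ (G ⊲ eblk (map □_ (A ∷ As) ++ Γ ⇒ Δ) ([] ⇒ [ B ]) ([ B ] ⇒ []))
    block true M = ruleM {G = G} M (unfold-block G A As ok fwd' λ G' _ → ⊥L {G = G'})
    block false ¬M = unfold-block G A As ok fwd' (bwd ¬M)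

  ⊩⇒LNS : ∀ {Γ Δ} → Γ ⊩ Δ → ∀ G → LNS 𝒜 ⊢ (G ⊲ seq (Γ ⇒ Δ))
  ⊩⇒LNS (init a b) G with _ , Γ↭ ← ∈⇒↭-front a | _ , Δ↭ ← ∈⇒↭-front b =
    LNS-perm G (↭-sym Γ↭) (↭-sym Δ↭) (init {G = G})
  ⊩⇒LNS (left m rule ds) G with _ , Γ↭ ← ∈⇒↭-front m =
    LNS-perm G (↭-sym Γ↭) ↭-refl (LeftRule-LNS G rule λ {L} q →
      LNS-perm G (Perm.++⁺ˡ L Γ↭) ↭-refl (⊩⇒LNS (ds q) G))
  ⊩⇒LNS (right m rule ds) G with _ , Δ↭ ← ∈⇒↭-front m =
    LNS-perm G ↭-refl (↭-sym Δ↭) (RightRule-LNS G rule λ {R = R} q →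
      LNS-perm G ↭-refl (Perm.++⁺ˡ R Δ↭) (⊩⇒LNS (ds q) G))
  ⊩⇒LNS (box As m g ok d c) G with _ , Δ↭ ← ∈⇒↭-front m =
    LNS-perm G ↭-refl (↭-sym Δ↭) (LNS-contract-boxes G As g
      (box-LNS G As ok (⊩⇒LNS d) λ ¬M G' a → ⊩⇒LNS (c ¬M a) G'))

mainTheorem7 : (𝒜 : Axioms) (A : Fm) → E 𝒜 ⊢ A → LNS 𝒜 ⊢ seq ([] ⇒ [ A ])
mainTheorem7 𝒜 A ⊢A = ⊩⇒LNS 𝒜 (E⇒⊩ 𝒜 ⊢A) []
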